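{- Let $\Gamma$ be the linear cellular automaton over $(\mathbb{Z}/2\mathbb{Z})^3$ given by the matrix $\Gamma=\begin{pmatrix}0&0&1\\0&1&u\\1&u&0\end{pmatrix}\in\mathscr{M}_3(\mathbb{Z}/2\mathbb{Z})[u,u^{ -1}]$. Then $\overline{X_2(\Gamma)}$ contains the half-lines $\mathbb{R}_+(0,1)$ and $\mathbb{R}_+(1,1)$.
   Context: Linear CA: a matrix $M=\sum_k M_k u^k\in\mathscr{M}_d(R)[u,u^{ -1}]$ ($R$ a finite commutative ring) defines the CA on $(R^d)^{\mathbb{Z}}$ given by $(Mc)(x)=\sum_k M_k\,c(x-k)$ (configurations viewed as series $\sum_x c(x)u^x$ and multiplied by $M$). For a CA $H$ with state set $C$, $c\in C^{\mathbb{Z}}$, $q\in C$, $\phi_c(q)$ is the configuration equal to $q$ at position $0$ and to $c(z)$ at $z\neq0$; $H^y_{x,c}:C\to C$ is $q\mapsto (H^y(\phi_c(q)))_x$. $H$ has property $P(x,y,l,r)$ ($x\in\mathbb{Z}$; $y,l,r\in\mathbb{N}$) if $H^y_{x,c}$ is a bijection for all $c$ and $H^y_{z,c}$ is constant for all $c$ and all integers $z\in[x-l,x+r]\setminus\{x\}$. For an integer $p\geq2$, $X_p(H)$ is the set of $(x,y)\in\mathbb{R}\times[0,+\infty)$ such that for some $k\in\mathbb{N}$, for every large enough $n$, $H$ has property $P(xp^n,yp^n,p^{n-k},p^{n-k})$; $\overline{X_p(H)}$ is its topological closure in $\mathbb{R}^2$.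
   Formalization: Only the points with rational coordinates on the half-lines ℝ₊(0,1) and ℝ₊(1,1) are treated, and membership in $\overline{X_2(\Gamma)}$ is tested with rational distances in the sup norm. -}

module Defs where

open import Data.Bool using (Bool; true; false; _xor_; _∧_)
open import Data.Nat as ℕ using (ℕ; zero; suc; _^_)
open import Data.Integer as ℤ using (ℤ; +_; _-_; _+_; _*_; _≤_)
open import Data.Fin using (Fin)
open import Data.Vec using (Vec; []; _∷_; lookup; tabulate)
open import Data.List using (List; []; _∷_; foldr; map; allFin)
open import Data.Product using (Σ; _×_; _,_; ∃)
open import Relation.Nullary using (¬_; yes; no)
open import Relation.Binary.PropositionalEquality using (_≡_)
open import Function.Definitions using (Bijective)
open import Data.Rational as ℚ using (ℚ; ½; 1ℚ)

Config : Set → Set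
Config C = ℤ → C

iter : {C : Set} → (Config C → Config C) → ℕ → Config C → Config C
iter H zero    c = c
iter H (suc y) c = H (iter H y c)

φ : {C : Set} → Config C → C → Config C
φ c q z with z ℤ.≟ + 0
... | yes _ = q
... | no  _ = c z

local : {C : Set} → (Config C → Config C) → ℕ → ℤ → Config C → C → C
local H y x c q = iter H y (φ c q) x

Constant : {C : Set} → (C → C) → Set
Constant f = ∀ q q' → f q ≡ f q'

P : {C : Set} → (Config C → Config C) → ℤ → ℕ → ℕ → ℕ → Set
P H x y l r =
  (∀ c → Bijective _≡_ _≡_ (local H y x c)) ×
  (∀ c (z : ℤ) → x - + l ≤ z → z ≤ x + + r → ¬ (z ≡ x) → Constant (local H y z c))

-- Linear CA over (ℤ/2ℤ)^d.  ℤ/2ℤ is modelled by Bool (+ = xor, · = ∧).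
-- A Laurent matrix Σ_k M_k u^k is a finite list of pairs (k , M_k).

Mat : ℕ → Set
Mat d = Fin d → Fin d → Bool

LaurentMat : ℕ → Set
LaurentMat d = List (ℤ × Mat d)

xorSum : List Bool → Bool
xorSum = foldr _xor_ false

matVec : {d : ℕ} → Mat d → Vec Bool d → Vec Bool d
matVec {d} M v = tabulate λ i → xorSum (map (λ j → M i j ∧ lookup v j) (allFin d))

vadd : {d : ℕ} → Vec Bool d → Vec Bool d → Vec Bool d
vadd []       []       = []
vadd (a ∷ as) (b ∷ bs) = (a xor b) ∷ vadd as bs

vzero : (d : ℕ) → Vec Bool d
vzero zero    = []
vzero (suc d) = false ∷ vzero d

linCA : {d : ℕ} → LaurentMat d → Config (Vec Bool d) → Config (Vec Bool d)
linCA {d} M c x = foldr (λ { (k , Mk) acc → vadd (matVec Mk (c (x - k))) acc }) (vzero d) M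

-- Γ = [[0,0,1],[0,1,u],[1,u,0]] = M₀ + M₁ u

Γ₀ : Mat 3
Γ₀ Fin.zero Fin.zero = false
Γ₀ Fin.zero (Fin.suc Fin.zero) = false
Γ₀ Fin.zero (Fin.suc (Fin.suc Fin.zero)) = true
Γ₀ (Fin.suc Fin.zero) Fin.zero = false
Γ₀ (Fin.suc Fin.zero) (Fin.suc Fin.zero) = true
Γ₀ (Fin.suc Fin.zero) (Fin.suc (Fin.suc Fin.zero)) = false
Γ₀ (Fin.suc (Fin.suc Fin.zero)) Fin.zero = true
Γ₀ (Fin.suc (Fin.suc Fin.zero)) (Fin.suc Fin.zero) = false
Γ₀ (Fin.suc (Fin.suc Fin.zero)) (Fin.suc (Fin.suc Fin.zero)) = false

Γ₁ : Mat 3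
Γ₁ Fin.zero _ = false
Γ₁ (Fin.suc Fin.zero) Fin.zero = false
Γ₁ (Fin.suc Fin.zero) (Fin.suc Fin.zero) = false
Γ₁ (Fin.suc Fin.zero) (Fin.suc (Fin.suc Fin.zero)) = true
Γ₁ (Fin.suc (Fin.suc Fin.zero)) Fin.zero = false
Γ₁ (Fin.suc (Fin.suc Fin.zero)) (Fin.suc Fin.zero) = true
Γ₁ (Fin.suc (Fin.suc Fin.zero)) (Fin.suc (Fin.suc Fin.zero)) = false

ΓMat : LaurentMat 3
ΓMat = (+ 0 , Γ₀) ∷ (+ 1 , Γ₁) ∷ []

ΓCA : Config (Vec Bool 3) → Config (Vec Bool 3)
ΓCA = linCA ΓMat

-- If (x,y) ∈ X_2(H) then x·2^n ∈ ℤ and y·2^n ∈ ℕ for some n, so every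
-- point of X_2(H) is (a/2^j , b/2^j) with a : ℤ, b : ℕ, j : ℕ.
-- InX2 H a b j  ⇔  (a/2^j , b/2^j) ∈ X_2(H):
--   ∃ k, ∀ large n, P(a/2^j·2^n, b/2^j·2^n, 2^(n-k), 2^(n-k)).
-- "for every large enough n" is expressed by ∃ N with N ≥ j, N ≥ k (harmless,
-- the condition is upward closed in N), so the truncated subtractions are exact.

InX2 : {C : Set} → (Config C → Config C) → ℤ → ℕ → ℕ → Set
InX2 H a b j =
  Σ ℕ λ k → Σ ℕ λ N → (j ℕ.≤ N) × (k ℕ.≤ N) ×
    (∀ n → N ℕ.≤ n →
      P H (a * + (2 ^ (n ℕ.∸ j))) (b ℕ.* 2 ^ (n ℕ.∸ j)) (2 ^ (n ℕ.∸ k)) (2 ^ (n ℕ.∸ k)))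

half^ : ℕ → ℚ
half^ zero    = 1ℚ
half^ (suc j) = ½ ℚ.* half^ j

dyadic : ℤ → ℕ → ℚ
dyadic a j = (a ℚ./ 1) ℚ.* half^ j

-- the real point (px , py) lies in the closure of X_2(H); tested for rational
-- points with rational ε, in the sup norm.
InClosureX2 : {C : Set} → (Config C → Config C) → ℚ → ℚ → Set
InClosureX2 H px py = ∀ (ε : ℚ) → ℚ.0ℚ ℚ.< ε →
  Σ ℤ λ a → Σ ℕ λ b → Σ ℕ λ j → InX2 H a b j ×
    (ℚ.∣ dyadic a j ℚ.- px ∣ ℚ.< ε) × (ℚ.∣ dyadic (+ b) j ℚ.- py ∣ ℚ.< ε)

-- Polynomials in Γ and the shift u form a commutative algebra of characteristic 2, so squaring is
-- additive on them. Hence a splitting Γ^Y = u^X + G + H with deg G ≤ X − R and val H ≥ X + R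
-- doubles to Γ^2Y = u^2X + G² + H², with both margins doubled. Such a splitting makes the local
-- map of Γ^Y at X a translation and those at 0 < |z − X| ≤ l constant for l < R: property
-- P(X, Y, l, l). Computing coefficients gives Γ^8 = 1 + (val ≥ 5) and
-- Γ^40 = u^32 + (deg ≤ 27) + (val ≥ 37), and Γ^64 = u^32 Γ^32 + (deg ≤ 48) carries the latter
-- over to Γ^(32q+40) = u^(32q+32) + …; so (0, 8q/2^j) and ((32q+32)/2^j, (32q+40)/2^j) lie in
-- X_2(Γ), and such points are dense on both half-lines.

module Submission where

open import Defs
open import Algebra.Bundles using (CommutativeMonoid)
import Algebra.Properties.CommutativeSemigroup
open import Data.Bool using (Bool; true; false; _xor_; _∧_)
open import Data.Bool.Properties as BoolP using (xor-assoc; xor-comm; xor-identityʳ; xor-same; xor-∧-commutativeRing)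
open import Data.Empty using (⊥-elim)
open import Data.Integer as ℤ using (ℤ; +_; -[1+_]; +[1+_]; _-_; _+_; _⊖_)
import Data.Integer.Properties as ℤP
open import Data.Integer.Tactic.RingSolver using () renaming (solve-∀ to ℤ-solve-∀)
open import Data.List as List using (List; []; _∷_; _++_; replicate; take; drop)
open import Data.List.Relation.Unary.All using (All; []; _∷_; all?)
open import Data.Maybe using (just; nothing)
open import Data.Nat as ℕ using (ℕ; zero; suc; _^_)
open import Data.Nat.Coprimality using (Coprime)
open import Data.Nat.DivMod using (_/_; _%_; m/n*n≤m; m≡m%n+[m/n]*n; m%n<n)
import Data.Nat.Properties as ℕP
open import Data.Nat.Tactic.RingSolver using () renaming (solve-∀ to ℕ-solve-∀)
open import Data.Product using (Σ; _×_; _,_)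
open import Data.Rational as ℚ using (ℚ; mkℚ; ½; 0ℚ; _≤_)
import Data.Rational.Properties as ℚP
open import Data.Rational.Unnormalised as ℚᵘ using (mkℚᵘ; *≡*; *<*)
import Data.Rational.Unnormalised.Properties as ℚᵘP
open import Data.Sum using (inj₁; inj₂)
open import Data.Vec as Vec using (Vec; []; _∷_; tabulate)
import Data.Vec.Properties as VecP
open import Function.Definitions using (Bijective; Injective; Surjective)
open import Relation.Binary.Bundles using (Setoid)
open import Relation.Binary.PropositionalEquality
import Relation.Binary.Reasoning.Setoid as SetoidReasoning
open import Relation.Nullary using (¬_; yes; no)
open import Relation.Nullary.Decidable using (Dec; True; toWitness)
open import Tactic.RingSolver using (solve-∀)
open import Tactic.RingSolver.Core.AlmostCommutativeRing using (AlmostCommutativeRing; fromCommutativeRing)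

𝔽₂ : AlmostCommutativeRing _ _
𝔽₂ = fromCommutativeRing xor-∧-commutativeRing λ { false → just refl ; true → nothing }

xor-interchange : ∀ a b c d → (a xor b) xor (c xor d) ≡ (a xor c) xor (b xor d)
xor-interchange = solve-∀ 𝔽₂

vadd-assoc : ∀ {n} (u v w : Vec Bool n) → vadd (vadd u v) w ≡ vadd u (vadd v w)
vadd-assoc [] [] [] = refl
vadd-assoc (a ∷ u) (b ∷ v) (c ∷ w) = cong₂ _∷_ (xor-assoc a b c) (vadd-assoc u v w)

vadd-comm : ∀ {n} (u v : Vec Bool n) → vadd u v ≡ vadd v u
vadd-comm [] [] = refl
vadd-comm (a ∷ u) (b ∷ v) = cong₂ _∷_ (xor-comm a b) (vadd-comm u v)

vadd-identityˡ : ∀ {n} (u : Vec Bool n) → vadd (vzero n) u ≡ u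
vadd-identityˡ [] = refl
vadd-identityˡ (a ∷ u) = cong (a ∷_) (vadd-identityˡ u)

vadd-identityʳ : ∀ {n} (u : Vec Bool n) → vadd u (vzero n) ≡ u
vadd-identityʳ u = trans (vadd-comm u _) (vadd-identityˡ u)

vadd-self : ∀ {n} (u : Vec Bool n) → vadd u u ≡ vzero n
vadd-self [] = refl
vadd-self (a ∷ u) = cong₂ _∷_ (xor-same a) (vadd-self u)

vadd-interchange : ∀ {n} (a b c d : Vec Bool n) → vadd (vadd a b) (vadd c d) ≡ vadd (vadd a c) (vadd b d)
vadd-interchange [] [] [] [] = refl
vadd-interchange (a ∷ as) (b ∷ bs) (c ∷ cs) (d ∷ ds) =
  cong₂ _∷_ (xor-interchange a b c d) (vadd-interchange as bs cs ds)

vadd-cancelʳ : ∀ {n} (q K : Vec Bool n) → vadd (vadd q K) K ≡ q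
vadd-cancelʳ q K = trans (vadd-assoc q K K) (trans (cong (vadd q) (vadd-self K)) (vadd-identityʳ q))

translation-bijective : ∀ {n} {K : Vec Bool n} (f : Vec Bool n → Vec Bool n) →
  (∀ q → f q ≡ vadd q K) → Bijective _≡_ _≡_ f
translation-bijective {K = K} f f-translates = injective , surjective
  where
  injective : Injective _≡_ _≡_ f
  injective {q} {q′} fq≡fq′ = begin
    q                  ≡⟨ sym (vadd-cancelʳ q K) ⟩
    vadd (vadd q K) K  ≡⟨ cong (λ v → vadd v K) (trans (sym (f-translates q)) (trans fq≡fq′ (f-translates q′))) ⟩
    vadd (vadd q′ K) K ≡⟨ vadd-cancelʳ q′ K ⟩
    q′                 ∎
    where open ≡-Reasoning
  surjective : Surjective _≡_ _≡_ f
  surjective v = vadd v K , λ { refl → trans (f-translates (vadd v K)) (vadd-cancelʳ v K) }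

sub-comm : ∀ z a b → z - a - b ≡ z - b - a
sub-comm = ℤ-solve-∀

sub-+ : ∀ z a b → z - (a + b) ≡ z - a - b
sub-+ = ℤ-solve-∀

sub-monoˡ-≤ : ∀ k {a b} → a ℤ.≤ b → a - k ℤ.≤ b - k
sub-monoˡ-≤ k = ℤP.+-monoˡ-≤ (ℤ.- k)

sub-monoʳ-≤ : ∀ z {a b} → a ℤ.≤ b → z - b ℤ.≤ z - a
sub-monoʳ-≤ z a≤b = ℤP.+-monoʳ-≤ z (ℤP.neg-mono-≤ a≤b)

sub-cancelˡ-≤ : ∀ x {a b} → x - a ℤ.≤ x - b → b ℤ.≤ a
sub-cancelˡ-≤ x {a} {b} le = ℤP.neg-cancel-≤ (subst₂ ℤ._≤_ (cancel x a) (cancel x b) (ℤP.+-monoʳ-≤ (ℤ.- x) le))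
  where
  cancel : ∀ x a → ℤ.- x + (x - a) ≡ ℤ.- a
  cancel = ℤ-solve-∀

𝔽₂³ : Set
𝔽₂³ = Vec Bool 3

Γ-rule : 𝔽₂³ → 𝔽₂³ → 𝔽₂³
Γ-rule (a ∷ b ∷ d ∷ []) (a′ ∷ b′ ∷ d′ ∷ []) = d ∷ (b xor d′) ∷ (a xor b′) ∷ []

ΓMat-rule : ∀ v v′ → vadd (matVec Γ₀ v) (vadd (matVec Γ₁ v′) (vzero 3)) ≡ Γ-rule v v′
ΓMat-rule (a ∷ b ∷ d ∷ []) (a′ ∷ b′ ∷ d′ ∷ []) =
  cong₂ _∷_ (drop-falses₁ d) (cong₂ _∷_ (drop-falses₂ b d′) (cong₂ _∷_ (drop-falses₂ a b′) refl))
  where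
  drop-falses₁ : ∀ x → (x xor false) xor false ≡ x
  drop-falses₁ = solve-∀ 𝔽₂
  drop-falses₂ : ∀ x y → (x xor false) xor ((y xor false) xor false) ≡ x xor y
  drop-falses₂ = solve-∀ 𝔽₂

ΓCA-rule : ∀ c z → ΓCA c z ≡ Γ-rule (c z) (c (z - + 1))
ΓCA-rule c z =
  trans (cong (λ w → vadd (matVec Γ₀ (c w)) (vadd (matVec Γ₁ (c (z - + 1))) (vzero 3))) (ℤP.+-identityʳ z))
        (ΓMat-rule (c z) (c (z - + 1)))

Γ-rule-additive : ∀ v w v′ w′ → Γ-rule (vadd v w) (vadd v′ w′) ≡ vadd (Γ-rule v v′) (Γ-rule w w′)
Γ-rule-additive (a ∷ b ∷ d ∷ []) (a₂ ∷ b₂ ∷ d₂ ∷ []) (a′ ∷ b′ ∷ d′ ∷ []) (a₂′ ∷ b₂′ ∷ d₂′ ∷ []) =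
  cong ((d xor d₂) ∷_) (cong₂ _∷_ (xor-interchange b b₂ d′ d₂′) (cong (_∷ []) (xor-interchange a a₂ b′ b₂′)))

_+ᶜ_ : Config 𝔽₂³ → Config 𝔽₂³ → Config 𝔽₂³
(c +ᶜ c′) z = vadd (c z) (c′ z)

infixl 6 _⊕_
infixl 7 _⊙_

data Expr : Set where
  𝟎 𝟏 Γ : Expr
  u^_ : ℕ → Expr
  _⊕_ _⊙_ : Expr → Expr → Expr

⟦_⟧ : Expr → Config 𝔽₂³ → Config 𝔽₂³
⟦ 𝟎 ⟧ c z = vzero 3
⟦ 𝟏 ⟧ c z = c z
⟦ Γ ⟧ c z = Γ-rule (c z) (c (z - + 1))
⟦ u^ k ⟧ c z = c (z - + k)
⟦ e ⊕ f ⟧ c z = vadd (⟦ e ⟧ c z) (⟦ f ⟧ c z)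
⟦ e ⊙ f ⟧ c z = ⟦ e ⟧ (⟦ f ⟧ c) z

Γ^_ : ℕ → Expr
Γ^ zero = 𝟏
Γ^ suc n = Γ ⊙ Γ^ n

⟦⟧-cong : ∀ e {c c′} → (∀ w → c w ≡ c′ w) → ∀ z → ⟦ e ⟧ c z ≡ ⟦ e ⟧ c′ z
⟦⟧-cong 𝟎 c≗c′ z = refl
⟦⟧-cong 𝟏 c≗c′ z = c≗c′ z
⟦⟧-cong Γ c≗c′ z = cong₂ Γ-rule (c≗c′ z) (c≗c′ (z - + 1))
⟦⟧-cong (u^ k) c≗c′ z = c≗c′ (z - + k)
⟦⟧-cong (e ⊕ f) c≗c′ z = cong₂ vadd (⟦⟧-cong e c≗c′ z) (⟦⟧-cong f c≗c′ z)
⟦⟧-cong (e ⊙ f) c≗c′ z = ⟦⟧-cong e (⟦⟧-cong f c≗c′) z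

⟦⟧-additive : ∀ e c c′ z → ⟦ e ⟧ (c +ᶜ c′) z ≡ vadd (⟦ e ⟧ c z) (⟦ e ⟧ c′ z)
⟦⟧-additive 𝟎 c c′ z = sym (vadd-self (vzero 3))
⟦⟧-additive 𝟏 c c′ z = refl
⟦⟧-additive Γ c c′ z = Γ-rule-additive (c z) (c′ z) (c (z - + 1)) (c′ (z - + 1))
⟦⟧-additive (u^ k) c c′ z = refl
⟦⟧-additive (e ⊕ f) c c′ z =
  trans (cong₂ vadd (⟦⟧-additive e c c′ z) (⟦⟧-additive f c c′ z)) (vadd-interchange _ _ _ _)
⟦⟧-additive (e ⊙ f) c c′ z = trans (⟦⟧-cong e (⟦⟧-additive f c c′) z) (⟦⟧-additive e (⟦ f ⟧ c) (⟦ f ⟧ c′) z)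

⟦⟧-zero : ∀ e z → ⟦ e ⟧ (λ _ → vzero 3) z ≡ vzero 3
⟦⟧-zero 𝟎 z = refl
⟦⟧-zero 𝟏 z = refl
⟦⟧-zero Γ z = refl
⟦⟧-zero (u^ k) z = refl
⟦⟧-zero (e ⊕ f) z = cong₂ vadd (⟦⟧-zero e z) (⟦⟧-zero f z)
⟦⟧-zero (e ⊙ f) z = trans (⟦⟧-cong e (⟦⟧-zero f) z) (⟦⟧-zero e z)

⟦⟧-shift : ∀ e c k z → ⟦ e ⟧ (λ w → c (w - k)) z ≡ ⟦ e ⟧ c (z - k)
⟦⟧-shift 𝟎 c k z = refl
⟦⟧-shift 𝟏 c k z = refl
⟦⟧-shift Γ c k z = cong (Γ-rule (c (z - k))) (cong c (sub-comm z (+ 1) k))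
⟦⟧-shift (u^ n) c k z = cong c (sub-comm z (+ n) k)
⟦⟧-shift (e ⊕ f) c k z = cong₂ vadd (⟦⟧-shift e c k z) (⟦⟧-shift f c k z)
⟦⟧-shift (e ⊙ f) c k z = trans (⟦⟧-cong e (⟦⟧-shift f c k) z) (⟦⟧-shift e (⟦ f ⟧ c) k z)

Γ-commutes : ∀ f c z → ⟦ Γ ⟧ (⟦ f ⟧ c) z ≡ ⟦ f ⟧ (⟦ Γ ⟧ c) z
Γ-commutes 𝟎 c z = refl
Γ-commutes 𝟏 c z = refl
Γ-commutes Γ c z = refl
Γ-commutes (u^ k) c z = ⟦⟧-shift Γ c (+ k) z
Γ-commutes (f ⊕ g) c z =
  trans (⟦⟧-additive Γ (⟦ f ⟧ c) (⟦ g ⟧ c) z) (cong₂ vadd (Γ-commutes f c z) (Γ-commutes g c z))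
Γ-commutes (f ⊙ g) c z = trans (Γ-commutes f (⟦ g ⟧ c) z) (⟦⟧-cong f (Γ-commutes g c) z)

⟦⟧-commute : ∀ e f c z → ⟦ e ⟧ (⟦ f ⟧ c) z ≡ ⟦ f ⟧ (⟦ e ⟧ c) z
⟦⟧-commute 𝟎 f c z = sym (⟦⟧-zero f z)
⟦⟧-commute 𝟏 f c z = refl
⟦⟧-commute Γ f c z = Γ-commutes f c z
⟦⟧-commute (u^ k) f c z = sym (⟦⟧-shift f c (+ k) z)
⟦⟧-commute (e ⊕ g) f c z =
  trans (cong₂ vadd (⟦⟧-commute e f c z) (⟦⟧-commute g f c z)) (sym (⟦⟧-additive f (⟦ e ⟧ c) (⟦ g ⟧ c) z))
⟦⟧-commute (e ⊙ g) f c z = trans (⟦⟧-cong e (⟦⟧-commute g f c) z) (⟦⟧-commute e f (⟦ g ⟧ c) z)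

infix 4 _≋_
record _≋_ (e f : Expr) : Set where
  constructor pointwise≋
  field pointwise : ∀ c z → ⟦ e ⟧ c z ≡ ⟦ f ⟧ c z
open _≋_ public

≋-refl : ∀ {e} → e ≋ e
≋-refl = pointwise≋ λ c z → refl

≋-reflexive : ∀ {e f} → e ≡ f → e ≋ f
≋-reflexive refl = ≋-refl

≋-sym : ∀ {e f} → e ≋ f → f ≋ e
≋-sym e≋f = pointwise≋ λ c z → sym (pointwise e≋f c z)

≋-trans : ∀ {e f g} → e ≋ f → f ≋ g → e ≋ g
≋-trans e≋f f≋g = pointwise≋ λ c z → trans (pointwise e≋f c z) (pointwise f≋g c z)

≋-setoid : Setoid _ _
≋-setoid = record
  { Carrier = Expr
  ; _≈_ = _≋_
  ; isEquivalence = record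
    { refl = ≋-refl
    ; sym = ≋-sym
    ; trans = ≋-trans
    }
  }

module ≋-Reasoning = SetoidReasoning ≋-setoid

⊕-cong : ∀ {e e′ f f′} → e ≋ e′ → f ≋ f′ → e ⊕ f ≋ e′ ⊕ f′
⊕-cong e≋e′ f≋f′ = pointwise≋ λ c z → cong₂ vadd (pointwise e≋e′ c z) (pointwise f≋f′ c z)

⊙-cong : ∀ {e e′ f f′} → e ≋ e′ → f ≋ f′ → e ⊙ f ≋ e′ ⊙ f′
⊙-cong {e} e≋e′ f≋f′ = pointwise≋ λ c z → trans (⟦⟧-cong e (pointwise f≋f′ c) z) (pointwise e≋e′ _ z)

⊕-assoc : ∀ e f g → (e ⊕ f) ⊕ g ≋ e ⊕ (f ⊕ g)
⊕-assoc e f g = pointwise≋ λ c z → vadd-assoc _ _ _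

⊕-comm : ∀ e f → e ⊕ f ≋ f ⊕ e
⊕-comm e f = pointwise≋ λ c z → vadd-comm _ _

⊕-identityˡ : ∀ e → 𝟎 ⊕ e ≋ e
⊕-identityˡ e = pointwise≋ λ c z → vadd-identityˡ _

⊕-identityʳ : ∀ e → e ⊕ 𝟎 ≋ e
⊕-identityʳ e = pointwise≋ λ c z → vadd-identityʳ _

⊕-self : ∀ e → e ⊕ e ≋ 𝟎
⊕-self e = pointwise≋ λ c z → vadd-self _

⊙-distribˡ : ∀ e f g → e ⊙ (f ⊕ g) ≋ e ⊙ f ⊕ e ⊙ g
⊙-distribˡ e f g = pointwise≋ λ c z → ⟦⟧-additive e (⟦ f ⟧ c) (⟦ g ⟧ c) z

⊙-assoc : ∀ e f g → (e ⊙ f) ⊙ g ≋ e ⊙ (f ⊙ g)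
⊙-assoc e f g = pointwise≋ λ c z → refl

⊙-identityˡ : ∀ e → 𝟏 ⊙ e ≋ e
⊙-identityˡ e = pointwise≋ λ c z → refl

⊙-distribʳ : ∀ e f g → (e ⊕ f) ⊙ g ≋ e ⊙ g ⊕ f ⊙ g
⊙-distribʳ e f g = pointwise≋ λ c z → refl

⊙-comm : ∀ e f → e ⊙ f ≋ f ⊙ e
⊙-comm e f = pointwise≋ (⟦⟧-commute e f)

u^-+ : ∀ a b → u^ (a ℕ.+ b) ≋ u^ a ⊙ u^ b
u^-+ a b = pointwise≋ λ c z → cong c (trans (cong (z -_) (ℤP.pos-+ a b)) (sub-+ z (+ a) (+ b)))

Γ^-+ : ∀ a b → Γ^ (a ℕ.+ b) ≋ Γ^ a ⊙ Γ^ b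
Γ^-+ zero b = ≋-sym (⊙-identityˡ (Γ^ b))
Γ^-+ (suc a) b = ≋-trans (⊙-cong {Γ} ≋-refl (Γ^-+ a b)) (≋-sym (⊙-assoc Γ (Γ^ a) (Γ^ b)))

⊕-commutativeMonoid : CommutativeMonoid _ _
⊕-commutativeMonoid = record
  { Carrier = Expr
  ; _≈_ = _≋_
  ; _∙_ = _⊕_
  ; ε = 𝟎
  ; isCommutativeMonoid = record
    { isMonoid = record
      { isSemigroup = record
        { isMagma = record { isEquivalence = Setoid.isEquivalence ≋-setoid ; ∙-cong = ⊕-cong }
        ; assoc = ⊕-assoc
        }
      ; identity = ⊕-identityˡ , ⊕-identityʳ
      }
    ; comm = ⊕-comm
    }
  }

module ⊕-Properties = Algebra.Properties.CommutativeSemigroup (CommutativeMonoid.commutativeSemigroup ⊕-commutativeMonoid)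

⊕-cancelˡ : ∀ e f → e ⊕ (e ⊕ f) ≋ f
⊕-cancelˡ e f = begin
  e ⊕ (e ⊕ f)  ≈⟨ ⊕-assoc e e f ⟨
  (e ⊕ e) ⊕ f  ≈⟨ ⊕-cong (⊕-self e) ≋-refl ⟩
  𝟎 ⊕ f        ≈⟨ ⊕-identityˡ f ⟩
  f            ∎
  where open ≋-Reasoning

⊕-cancelʳ : ∀ e f → (e ⊕ f) ⊕ f ≋ e
⊕-cancelʳ e f = begin
  (e ⊕ f) ⊕ f  ≈⟨ ⊕-assoc e f f ⟩
  e ⊕ (f ⊕ f)  ≈⟨ ⊕-cong ≋-refl (⊕-self f) ⟩
  e ⊕ 𝟎        ≈⟨ ⊕-identityʳ e ⟩
  e            ∎
  where open ≋-Reasoning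

-- In characteristic 2 the cross terms e ⊙ f and f ⊙ e cancel.
⊕-square : ∀ e f → (e ⊕ f) ⊙ (e ⊕ f) ≋ e ⊙ e ⊕ f ⊙ f
⊕-square e f = begin
  (e ⊕ f) ⊙ (e ⊕ f)                   ≈⟨ ⊙-distribˡ (e ⊕ f) e f ⟩
  (e ⊕ f) ⊙ e ⊕ (e ⊕ f) ⊙ f           ≈⟨ ⊕-cong (⊙-distribʳ e f e) (⊙-distribʳ e f f) ⟩
  (e ⊙ e ⊕ f ⊙ e) ⊕ (e ⊙ f ⊕ f ⊙ f)   ≈⟨ ⊕-cong (⊕-cong ≋-refl (⊙-comm f e)) ≋-refl ⟩
  (e ⊙ e ⊕ e ⊙ f) ⊕ (e ⊙ f ⊕ f ⊙ f)   ≈⟨ ⊕-assoc (e ⊙ e) (e ⊙ f) (e ⊙ f ⊕ f ⊙ f) ⟩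
  e ⊙ e ⊕ (e ⊙ f ⊕ (e ⊙ f ⊕ f ⊙ f))   ≈⟨ ⊕-cong ≋-refl (⊕-assoc (e ⊙ f) (e ⊙ f) (f ⊙ f)) ⟨
  e ⊙ e ⊕ ((e ⊙ f ⊕ e ⊙ f) ⊕ f ⊙ f)   ≈⟨ ⊕-cong ≋-refl (⊕-cong (⊕-self (e ⊙ f)) ≋-refl) ⟩
  e ⊙ e ⊕ (𝟎 ⊕ f ⊙ f)                 ≈⟨ ⊕-cong ≋-refl (⊕-identityˡ (f ⊙ f)) ⟩
  e ⊙ e ⊕ f ⊙ f                       ∎
  where open ≋-Reasoning

-- Degree and valuation in u, read off from the positions of c on which ⟦ e ⟧ c z depends:
-- u^ k makes it read c (z − k).
record DegreeAtMost (d : ℤ) (e : Expr) : Set where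
  constructor degree-≤
  field depends-above : ∀ c c′ z → (∀ w → z - d ℤ.≤ w → c w ≡ c′ w) → ⟦ e ⟧ c z ≡ ⟦ e ⟧ c′ z
open DegreeAtMost public

record ValuationAtLeast (d : ℤ) (e : Expr) : Set where
  constructor valuation-≥
  field depends-below : ∀ c c′ z → (∀ w → w ℤ.≤ z - d → c w ≡ c′ w) → ⟦ e ⟧ c z ≡ ⟦ e ⟧ c′ z
open ValuationAtLeast public

DegreeAtMost-mono : ∀ {d d′ e} → d ℤ.≤ d′ → DegreeAtMost d e → DegreeAtMost d′ e
DegreeAtMost-mono d≤d′ (degree-≤ deg) = degree-≤ λ c c′ z agree →
  deg c c′ z λ w le → agree w (ℤP.≤-trans (sub-monoʳ-≤ z d≤d′) le)

DegreeAtMost-resp-≋ : ∀ {d e f} → e ≋ f → DegreeAtMost d e → DegreeAtMost d f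
DegreeAtMost-resp-≋ e≋f (degree-≤ deg) = degree-≤ λ c c′ z agree →
  trans (sym (pointwise e≋f c z)) (trans (deg c c′ z agree) (pointwise e≋f c′ z))

ValuationAtLeast-resp-≋ : ∀ {d e f} → e ≋ f → ValuationAtLeast d e → ValuationAtLeast d f
ValuationAtLeast-resp-≋ e≋f (valuation-≥ val) = valuation-≥ λ c c′ z agree →
  trans (sym (pointwise e≋f c z)) (trans (val c c′ z agree) (pointwise e≋f c′ z))

DegreeAtMost-𝟎 : ∀ {d} → DegreeAtMost d 𝟎
DegreeAtMost-𝟎 = degree-≤ λ c c′ z agree → refl

ValuationAtLeast-𝟎 : ∀ {d} → ValuationAtLeast d 𝟎
ValuationAtLeast-𝟎 = valuation-≥ λ c c′ z agree → refl

DegreeAtMost-u^ : ∀ k → DegreeAtMost (+ k) (u^ k)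
DegreeAtMost-u^ k = degree-≤ λ c c′ z agree → agree (z - + k) ℤP.≤-refl

ValuationAtLeast-u^ : ∀ k → ValuationAtLeast (+ k) (u^ k)
ValuationAtLeast-u^ k = valuation-≥ λ c c′ z agree → agree (z - + k) ℤP.≤-refl

DegreeAtMost-⊕ : ∀ {d e f} → DegreeAtMost d e → DegreeAtMost d f → DegreeAtMost d (e ⊕ f)
DegreeAtMost-⊕ (degree-≤ deg₁) (degree-≤ deg₂) = degree-≤ λ c c′ z agree →
  cong₂ vadd (deg₁ c c′ z agree) (deg₂ c c′ z agree)

ValuationAtLeast-⊕ : ∀ {d e f} → ValuationAtLeast d e → ValuationAtLeast d f → ValuationAtLeast d (e ⊕ f)
ValuationAtLeast-⊕ (valuation-≥ val₁) (valuation-≥ val₂) = valuation-≥ λ c c′ z agree →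
  cong₂ vadd (val₁ c c′ z agree) (val₂ c c′ z agree)

DegreeAtMost-⊙ : ∀ {d₁ d₂ e f} → DegreeAtMost d₁ e → DegreeAtMost d₂ f → DegreeAtMost (d₁ + d₂) (e ⊙ f)
DegreeAtMost-⊙ {d₁} {d₂} {f = f} (degree-≤ deg₁) (degree-≤ deg₂) = degree-≤ λ c c′ z agree →
  deg₁ (⟦ f ⟧ c) (⟦ f ⟧ c′) z λ v z-d₁≤v → deg₂ c c′ v λ w v-d₂≤w →
    agree w (ℤP.≤-trans (ℤP.≤-reflexive (sub-+ z d₁ d₂)) (ℤP.≤-trans (sub-monoˡ-≤ d₂ z-d₁≤v) v-d₂≤w))

ValuationAtLeast-⊙ : ∀ {d₁ d₂ e f} → ValuationAtLeast d₁ e → ValuationAtLeast d₂ f → ValuationAtLeast (d₁ + d₂) (e ⊙ f)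
ValuationAtLeast-⊙ {d₁} {d₂} {f = f} (valuation-≥ val₁) (valuation-≥ val₂) = valuation-≥ λ c c′ z agree →
  val₁ (⟦ f ⟧ c) (⟦ f ⟧ c′) z λ v v≤z-d₁ → val₂ c c′ v λ w w≤v-d₂ →
    agree w (ℤP.≤-trans w≤v-d₂ (ℤP.≤-trans (sub-monoˡ-≤ d₂ v≤z-d₁) (ℤP.≤-reflexive (sym (sub-+ z d₁ d₂)))))

DegreeAtMost-Γ : DegreeAtMost (+ 1) Γ
DegreeAtMost-Γ = degree-≤ λ c c′ z agree → cong₂ Γ-rule (agree z (ℤP.i-j≤i z (+ 1))) (agree (z - + 1) ℤP.≤-refl)

DegreeAtMost-Γ^ : ∀ n → DegreeAtMost (+ n) (Γ^ n)
DegreeAtMost-Γ^ zero = degree-≤ λ c c′ z agree → agree z (ℤP.≤-reflexive (ℤP.+-identityʳ z))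
DegreeAtMost-Γ^ (suc n) = DegreeAtMost-⊙ DegreeAtMost-Γ (DegreeAtMost-Γ^ n)

-- Normal forms: Σₖ Aₖ uᵏ as the list A₀ ∷ A₁ ∷ …, a 3 × 3 matrix being the vector of its rows.
-- Degree and valuation bounds of closed expressions are decided by computing normal forms.
Matrix : Set
Matrix = Vec 𝔽₂³ 3

dot : 𝔽₂³ → 𝔽₂³ → Bool
dot (a ∷ b ∷ d ∷ []) (x ∷ y ∷ w ∷ []) = (a ∧ x) xor ((b ∧ y) xor (d ∧ w))

act : Matrix → 𝔽₂³ → 𝔽₂³
act (r₀ ∷ r₁ ∷ r₂ ∷ []) v = dot r₀ v ∷ dot r₁ v ∷ dot r₂ v ∷ []

_·ᵥ_ : Bool → 𝔽₂³ → 𝔽₂³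
s ·ᵥ (x ∷ y ∷ w ∷ []) = (s ∧ x) ∷ (s ∧ y) ∷ (s ∧ w) ∷ []

_+ₘ_ : Matrix → Matrix → Matrix
(r₀ ∷ r₁ ∷ r₂ ∷ []) +ₘ (s₀ ∷ s₁ ∷ s₂ ∷ []) = vadd r₀ s₀ ∷ vadd r₁ s₁ ∷ vadd r₂ s₂ ∷ []

rowCombination : 𝔽₂³ → Matrix → 𝔽₂³
rowCombination (a₀ ∷ a₁ ∷ a₂ ∷ []) (r₀ ∷ r₁ ∷ r₂ ∷ []) = vadd (a₀ ·ᵥ r₀) (vadd (a₁ ·ᵥ r₁) (a₂ ·ᵥ r₂))

_·ₘ_ : Matrix → Matrix → Matrix
A ·ₘ B = Vec.map (λ a → rowCombination a B) A

𝟎ₘ : Matrix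
𝟎ₘ = vzero 3 ∷ vzero 3 ∷ vzero 3 ∷ []

𝟏ₘ : Matrix
𝟏ₘ = (true ∷ false ∷ false ∷ []) ∷ (false ∷ true ∷ false ∷ []) ∷ (false ∷ false ∷ true ∷ []) ∷ []

rows : Mat 3 → Matrix
rows M = tabulate λ i → tabulate (M i)

dot-vaddˡ : ∀ r s v → dot (vadd r s) v ≡ dot r v xor dot s v
dot-vaddˡ (a ∷ b ∷ d ∷ []) (a′ ∷ b′ ∷ d′ ∷ []) (x ∷ y ∷ w ∷ []) = bilinear a b d a′ b′ d′ x y w
  where
  bilinear : ∀ a b d a′ b′ d′ x y w →
    ((a xor a′) ∧ x) xor (((b xor b′) ∧ y) xor ((d xor d′) ∧ w)) ≡
    ((a ∧ x) xor ((b ∧ y) xor (d ∧ w))) xor ((a′ ∧ x) xor ((b′ ∧ y) xor (d′ ∧ w)))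
  bilinear = solve-∀ 𝔽₂

dot-vaddʳ : ∀ r u v → dot r (vadd u v) ≡ dot r u xor dot r v
dot-vaddʳ (a ∷ b ∷ d ∷ []) (x ∷ y ∷ w ∷ []) (x′ ∷ y′ ∷ w′ ∷ []) = bilinear a b d x y w x′ y′ w′
  where
  bilinear : ∀ a b d x y w x′ y′ w′ →
    (a ∧ (x xor x′)) xor ((b ∧ (y xor y′)) xor (d ∧ (w xor w′))) ≡
    ((a ∧ x) xor ((b ∧ y) xor (d ∧ w))) xor ((a ∧ x′) xor ((b ∧ y′) xor (d ∧ w′)))
  bilinear = solve-∀ 𝔽₂

dot-·ᵥ : ∀ s r v → dot (s ·ᵥ r) v ≡ s ∧ dot r v
dot-·ᵥ s (a ∷ b ∷ d ∷ []) (x ∷ y ∷ w ∷ []) = scaling s a b d x y w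
  where
  scaling : ∀ s a b d x y w →
    ((s ∧ a) ∧ x) xor (((s ∧ b) ∧ y) xor ((s ∧ d) ∧ w)) ≡ s ∧ ((a ∧ x) xor ((b ∧ y) xor (d ∧ w)))
  scaling = solve-∀ 𝔽₂

dot-vzeroʳ : ∀ r → dot r (vzero 3) ≡ false
dot-vzeroʳ (a ∷ b ∷ d ∷ []) = annihilate a b d
  where
  annihilate : ∀ a b d → (a ∧ false) xor ((b ∧ false) xor (d ∧ false)) ≡ false
  annihilate = solve-∀ 𝔽₂

act-+ₘ : ∀ A B v → act (A +ₘ B) v ≡ vadd (act A v) (act B v)
act-+ₘ (r₀ ∷ r₁ ∷ r₂ ∷ []) (s₀ ∷ s₁ ∷ s₂ ∷ []) v =
  cong₂ _∷_ (dot-vaddˡ r₀ s₀ v) (cong₂ _∷_ (dot-vaddˡ r₁ s₁ v) (cong (_∷ []) (dot-vaddˡ r₂ s₂ v)))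

act-vadd : ∀ A u v → act A (vadd u v) ≡ vadd (act A u) (act A v)
act-vadd (r₀ ∷ r₁ ∷ r₂ ∷ []) u v =
  cong₂ _∷_ (dot-vaddʳ r₀ u v) (cong₂ _∷_ (dot-vaddʳ r₁ u v) (cong (_∷ []) (dot-vaddʳ r₂ u v)))

act-vzero : ∀ A → act A (vzero 3) ≡ vzero 3
act-vzero (r₀ ∷ r₁ ∷ r₂ ∷ []) =
  cong₂ _∷_ (dot-vzeroʳ r₀) (cong₂ _∷_ (dot-vzeroʳ r₁) (cong (_∷ []) (dot-vzeroʳ r₂)))

act-𝟎ₘ : ∀ v → act 𝟎ₘ v ≡ vzero 3
act-𝟎ₘ (x ∷ y ∷ w ∷ []) = refl

act-𝟏ₘ : ∀ v → act 𝟏ₘ v ≡ v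
act-𝟏ₘ (x ∷ y ∷ w ∷ []) = cong₂ _∷_ (xor-identityʳ x) (cong (_∷ w ∷ []) (xor-identityʳ y))

dot-rowCombination : ∀ a B v → dot (rowCombination a B) v ≡ dot a (act B v)
dot-rowCombination (s₀ ∷ s₁ ∷ s₂ ∷ []) (r₀ ∷ r₁ ∷ r₂ ∷ []) v =
  trans (dot-vaddˡ (s₀ ·ᵥ r₀) _ v) (cong₂ _xor_ (dot-·ᵥ s₀ r₀ v)
    (trans (dot-vaddˡ (s₁ ·ᵥ r₁) _ v) (cong₂ _xor_ (dot-·ᵥ s₁ r₁ v) (dot-·ᵥ s₂ r₂ v))))

act-·ₘ : ∀ A B v → act (A ·ₘ B) v ≡ act A (act B v)
act-·ₘ (a₀ ∷ a₁ ∷ a₂ ∷ []) B v =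
  cong₂ _∷_ (dot-rowCombination a₀ B v) (cong₂ _∷_ (dot-rowCombination a₁ B v) (cong (_∷ []) (dot-rowCombination a₂ B v)))

⟪_⟫ : List Matrix → Config 𝔽₂³ → Config 𝔽₂³
⟪ [] ⟫ c z = vzero 3
⟪ A ∷ As ⟫ c z = vadd (act A (c z)) (⟪ As ⟫ c (z - + 1))

infixl 6 _+ₚ_
infixl 7 _*ₚ_

_+ₚ_ : List Matrix → List Matrix → List Matrix
[] +ₚ Bs = Bs
(A ∷ As) +ₚ [] = A ∷ As
(A ∷ As) +ₚ (B ∷ Bs) = A +ₘ B ∷ As +ₚ Bs

_*ₚ_ : List Matrix → List Matrix → List Matrix
[] *ₚ Bs = []
(A ∷ As) *ₚ Bs = List.map (A ·ₘ_) Bs +ₚ (𝟎ₘ ∷ As *ₚ Bs)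

nf : Expr → List Matrix
nf 𝟎 = []
nf 𝟏 = 𝟏ₘ ∷ []
nf Γ = rows Γ₀ ∷ rows Γ₁ ∷ []
nf (u^ k) = replicate k 𝟎ₘ ++ 𝟏ₘ ∷ []
nf (e ⊕ f) = nf e +ₚ nf f
nf (e ⊙ f) = nf e *ₚ nf f

⟪⟫-𝟎ₘ∷ : ∀ As c z → ⟪ 𝟎ₘ ∷ As ⟫ c z ≡ ⟪ As ⟫ c (z - + 1)
⟪⟫-𝟎ₘ∷ As c z = trans (cong (λ v → vadd v (⟪ As ⟫ c (z - + 1))) (act-𝟎ₘ (c z))) (vadd-identityˡ _)

⟪⟫-+ₚ : ∀ As Bs c z → ⟪ As +ₚ Bs ⟫ c z ≡ vadd (⟪ As ⟫ c z) (⟪ Bs ⟫ c z)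
⟪⟫-+ₚ [] Bs c z = sym (vadd-identityˡ _)
⟪⟫-+ₚ (A ∷ As) [] c z = sym (vadd-identityʳ _)
⟪⟫-+ₚ (A ∷ As) (B ∷ Bs) c z =
  trans (cong₂ vadd (act-+ₘ A B (c z)) (⟪⟫-+ₚ As Bs c (z - + 1))) (vadd-interchange _ _ _ _)

⟪⟫-·ₘ : ∀ A Bs c z → ⟪ List.map (A ·ₘ_) Bs ⟫ c z ≡ act A (⟪ Bs ⟫ c z)
⟪⟫-·ₘ A [] c z = sym (act-vzero A)
⟪⟫-·ₘ A (B ∷ Bs) c z =
  trans (cong₂ vadd (act-·ₘ A B (c z)) (⟪⟫-·ₘ A Bs c (z - + 1))) (sym (act-vadd A _ _))

⟪⟫-*ₚ : ∀ As Bs c z → ⟪ As *ₚ Bs ⟫ c z ≡ ⟪ As ⟫ (⟪ Bs ⟫ c) z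
⟪⟫-*ₚ [] Bs c z = refl
⟪⟫-*ₚ (A ∷ As) Bs c z =
  trans (⟪⟫-+ₚ (List.map (A ·ₘ_) Bs) (𝟎ₘ ∷ As *ₚ Bs) c z)
    (cong₂ vadd (⟪⟫-·ₘ A Bs c z) (trans (⟪⟫-𝟎ₘ∷ (As *ₚ Bs) c z) (⟪⟫-*ₚ As Bs c (z - + 1))))

⟪⟫-shift : ∀ k As c z → ⟪ replicate k 𝟎ₘ ++ As ⟫ c z ≡ ⟪ As ⟫ c (z - + k)
⟪⟫-shift zero As c z = cong (⟪ As ⟫ c) (sym (ℤP.+-identityʳ z))
⟪⟫-shift (suc k) As c z =
  trans (⟪⟫-𝟎ₘ∷ (replicate k 𝟎ₘ ++ As) c z)
    (trans (⟪⟫-shift k As c (z - + 1)) (cong (⟪ As ⟫ c) (sym (sub-+ z (+ 1) (+ k)))))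

nf-sound : ∀ e c z → ⟦ e ⟧ c z ≡ ⟪ nf e ⟫ c z
nf-sound 𝟎 c z = refl
nf-sound 𝟏 c z = sym (trans (vadd-identityʳ _) (act-𝟏ₘ (c z)))
nf-sound Γ c z = nf-Γ (c z) (c (z - + 1))
  where
  nf-Γ : ∀ v v′ → Γ-rule v v′ ≡ vadd (act (rows Γ₀) v) (vadd (act (rows Γ₁) v′) (vzero 3))
  nf-Γ (a ∷ b ∷ d ∷ []) (a′ ∷ b′ ∷ d′ ∷ []) =
    cong₂ _∷_ (sym (xor-identityʳ d)) (cong₂ _∷_ (pad₁ b d′) (cong (_∷ []) (pad₂ a b′)))
    where
    pad₁ : ∀ x y → x xor y ≡ (x xor false) xor (y xor false)
    pad₁ = solve-∀ 𝔽₂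
    pad₂ : ∀ x y → x xor y ≡ (x xor false) xor ((y xor false) xor false)
    pad₂ = solve-∀ 𝔽₂
nf-sound (u^ k) c z = sym (trans (⟪⟫-shift k (𝟏ₘ ∷ []) c z) (trans (vadd-identityʳ _) (act-𝟏ₘ _)))
nf-sound (e ⊕ f) c z = trans (cong₂ vadd (nf-sound e c z) (nf-sound f c z)) (sym (⟪⟫-+ₚ (nf e) (nf f) c z))
nf-sound (e ⊙ f) c z =
  trans (⟦⟧-cong e (nf-sound f c) z) (trans (nf-sound e (⟪ nf f ⟫ c) z) (sym (⟪⟫-*ₚ (nf e) (nf f) c z)))

_≟𝟎ₘ : ∀ A → Dec (A ≡ 𝟎ₘ)
A ≟𝟎ₘ = VecP.≡-dec (VecP.≡-dec BoolP._≟_) A 𝟎ₘ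

⟪⟫-zeros : ∀ {As} → All (_≡ 𝟎ₘ) As → ∀ c z → ⟪ As ⟫ c z ≡ vzero 3
⟪⟫-zeros [] c z = refl
⟪⟫-zeros {_ ∷ As} (refl ∷ zeros) c z = trans (⟪⟫-𝟎ₘ∷ As c z) (⟪⟫-zeros zeros c (z - + 1))

⟪⟫-depends-above : ∀ k As → All (_≡ 𝟎ₘ) (drop (suc k) As) →
  ∀ c c′ z → (∀ w → z - + k ℤ.≤ w → c w ≡ c′ w) → ⟪ As ⟫ c z ≡ ⟪ As ⟫ c′ z
⟪⟫-depends-above k [] zeros c c′ z agree = refl
⟪⟫-depends-above zero (A ∷ As) zeros c c′ z agree =
  cong₂ vadd (cong (act A) (agree z (ℤP.≤-reflexive (ℤP.+-identityʳ z))))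
             (trans (⟪⟫-zeros zeros c (z - + 1)) (sym (⟪⟫-zeros zeros c′ (z - + 1))))
⟪⟫-depends-above (suc k) (A ∷ As) zeros c c′ z agree =
  cong₂ vadd (cong (act A) (agree z (ℤP.i-j≤i z (+ suc k))))
             (⟪⟫-depends-above k As zeros c c′ (z - + 1) λ w le →
               agree w (ℤP.≤-trans (ℤP.≤-reflexive (sub-+ z (+ 1) (+ k))) le))

⟪⟫-causal : ∀ As c c′ z → (∀ w → w ℤ.≤ z → c w ≡ c′ w) → ⟪ As ⟫ c z ≡ ⟪ As ⟫ c′ z
⟪⟫-causal [] c c′ z agree = refl
⟪⟫-causal (A ∷ As) c c′ z agree =
  cong₂ vadd (cong (act A) (agree z ℤP.≤-refl))
             (⟪⟫-causal As c c′ (z - + 1) λ w le → agree w (ℤP.≤-trans le (ℤP.i-j≤i z (+ 1))))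

⟪⟫-depends-below : ∀ k As → All (_≡ 𝟎ₘ) (take k As) →
  ∀ c c′ z → (∀ w → w ℤ.≤ z - + k → c w ≡ c′ w) → ⟪ As ⟫ c z ≡ ⟪ As ⟫ c′ z
⟪⟫-depends-below k [] zeros c c′ z agree = refl
⟪⟫-depends-below zero (A ∷ As) zeros c c′ z agree =
  ⟪⟫-causal (A ∷ As) c c′ z λ w w≤z → agree w (ℤP.≤-trans w≤z (ℤP.≤-reflexive (sym (ℤP.+-identityʳ z))))
⟪⟫-depends-below (suc k) (A ∷ As) (refl ∷ zeros) c c′ z agree =
  trans (⟪⟫-𝟎ₘ∷ As c z) (trans (⟪⟫-depends-below k As zeros c c′ (z - + 1) λ w le →
    agree w (ℤP.≤-trans le (ℤP.≤-reflexive (sym (sub-+ z (+ 1) (+ k))))))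
    (sym (⟪⟫-𝟎ₘ∷ As c′ z)))

DegreeAtMost-by-nf : ∀ k e → True (all? _≟𝟎ₘ (drop (suc k) (nf e))) → DegreeAtMost (+ k) e
DegreeAtMost-by-nf k e zeros = degree-≤ λ c c′ z agree →
  trans (nf-sound e c z) (trans (⟪⟫-depends-above k (nf e) (toWitness zeros) c c′ z agree) (sym (nf-sound e c′ z)))

ValuationAtLeast-by-nf : ∀ k e → True (all? _≟𝟎ₘ (take k (nf e))) → ValuationAtLeast (+ k) e
ValuationAtLeast-by-nf k e zeros = valuation-≥ λ c c′ z agree →
  trans (nf-sound e c z) (trans (⟪⟫-depends-below k (nf e) (toWitness zeros) c c′ z agree) (sym (nf-sound e c′ z)))

ValuationAtLeast-0 : ∀ e → ValuationAtLeast (+ 0) e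
ValuationAtLeast-0 e = ValuationAtLeast-by-nf 0 e _

u^0≋𝟏 : u^ 0 ≋ 𝟏
u^0≋𝟏 = pointwise≋ λ c z → cong c (ℤP.+-identityʳ z)

AgreeAbove : ℤ → Expr → Expr → Set
AgreeAbove d e f = DegreeAtMost d (e ⊕ f)

AgreeBelow : ℤ → Expr → Expr → Set
AgreeBelow d e f = ValuationAtLeast d (e ⊕ f)

≋⇒AgreeAbove : ∀ {d e f} → e ≋ f → AgreeAbove d e f
≋⇒AgreeAbove {f = f} e≋f = DegreeAtMost-resp-≋ (≋-sym (≋-trans (⊕-cong e≋f ≋-refl) (⊕-self f))) DegreeAtMost-𝟎

AgreeAbove-resp-≋ : ∀ {d e e′ f f′} → e ≋ e′ → f ≋ f′ → AgreeAbove d e f → AgreeAbove d e′ f′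
AgreeAbove-resp-≋ e≋e′ f≋f′ = DegreeAtMost-resp-≋ (⊕-cong e≋e′ f≋f′)

AgreeAbove-trans : ∀ {d e f g} → AgreeAbove d e f → AgreeAbove d f g → AgreeAbove d e g
AgreeAbove-trans {e = e} {f} {g} e~f f~g = DegreeAtMost-resp-≋ middle-cancels (DegreeAtMost-⊕ e~f f~g)
  where
  middle-cancels : (e ⊕ f) ⊕ (f ⊕ g) ≋ e ⊕ g
  middle-cancels = ≋-trans (⊕-assoc e f (f ⊕ g)) (⊕-cong ≋-refl (⊕-cancelˡ f g))

AgreeAbove-⊙ˡ : ∀ {d d′ e f g} → DegreeAtMost d′ g → AgreeAbove d e f → AgreeAbove (d′ + d) (g ⊙ e) (g ⊙ f)
AgreeAbove-⊙ˡ {e = e} {f} {g} deg-g e~f = DegreeAtMost-resp-≋ (⊙-distribˡ g e f) (DegreeAtMost-⊙ deg-g e~f)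

AgreeBelow-resp-≋ : ∀ {d e e′ f f′} → e ≋ e′ → f ≋ f′ → AgreeBelow d e f → AgreeBelow d e′ f′
AgreeBelow-resp-≋ e≋e′ f≋f′ = ValuationAtLeast-resp-≋ (⊕-cong e≋e′ f≋f′)

AgreeBelow-⊙ : ∀ {d e f g h} → AgreeBelow d e f → AgreeBelow d g h → AgreeBelow d (e ⊙ g) (f ⊙ h)
AgreeBelow-⊙ {d} {e} {f} {g} {h} e~f g~h =
  ValuationAtLeast-resp-≋ telescope (ValuationAtLeast-⊕ left right)
  where
  left : ValuationAtLeast d ((e ⊕ f) ⊙ g)
  left = subst (λ d′ → ValuationAtLeast d′ ((e ⊕ f) ⊙ g)) (ℤP.+-identityʳ d)
    (ValuationAtLeast-⊙ e~f (ValuationAtLeast-0 g))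
  right : ValuationAtLeast d (f ⊙ (g ⊕ h))
  right = subst (λ d′ → ValuationAtLeast d′ (f ⊙ (g ⊕ h))) (ℤP.+-identityˡ d)
    (ValuationAtLeast-⊙ (ValuationAtLeast-0 f) g~h)
  telescope : (e ⊕ f) ⊙ g ⊕ f ⊙ (g ⊕ h) ≋ e ⊙ g ⊕ f ⊙ h
  telescope = begin
    (e ⊕ f) ⊙ g ⊕ f ⊙ (g ⊕ h)        ≈⟨ ⊕-cong (⊙-distribʳ e f g) (⊙-distribˡ f g h) ⟩
    (e ⊙ g ⊕ f ⊙ g) ⊕ (f ⊙ g ⊕ f ⊙ h)  ≈⟨ ⊕-assoc (e ⊙ g) (f ⊙ g) (f ⊙ g ⊕ f ⊙ h) ⟩
    e ⊙ g ⊕ (f ⊙ g ⊕ (f ⊙ g ⊕ f ⊙ h))  ≈⟨ ⊕-cong ≋-refl (⊕-cancelˡ (f ⊙ g) (f ⊙ h)) ⟩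
    e ⊙ g ⊕ f ⊙ h                    ∎
    where open ≋-Reasoning

iter-ΓCA : ∀ y c z → iter ΓCA y c z ≡ ⟦ Γ^ y ⟧ c z
iter-ΓCA zero c z = refl
iter-ΓCA (suc y) c z =
  trans (ΓCA-rule (iter ΓCA y c) z) (cong₂ Γ-rule (iter-ΓCA y c z) (iter-ΓCA y c (z - + 1)))

φ-at-0 : ∀ {C} (c : Config C) q → φ c q (+ 0) ≡ q
φ-at-0 c q with + 0 ℤ.≟ + 0
... | yes _ = refl
... | no 0≢0 = ⊥-elim (0≢0 refl)

φ-away-from-0 : ∀ {C} (c : Config C) q w → ¬ w ≡ + 0 → φ c q w ≡ c w
φ-away-from-0 c q w w≢0 with w ℤ.≟ + 0
... | yes w≡0 = ⊥-elim (w≢0 w≡0)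
... | no _ = refl

φ-independent-away-from-0 : ∀ {C} (c : Config C) q q′ w → ¬ w ≡ + 0 → φ c q w ≡ φ c q′ w
φ-independent-away-from-0 c q q′ w w≢0 = trans (φ-away-from-0 c q w w≢0) (sym (φ-away-from-0 c q′ w w≢0))

record Window (Y X R : ℕ) : Set where
  field
    low high : Expr
    split : Γ^ Y ≋ u^ X ⊕ (low ⊕ high)
    low-degree : DegreeAtMost (+ X - + R) low
    high-valuation : ValuationAtLeast (+ (X ℕ.+ R)) high

Window-cong : ∀ {Y X R Y′ X′ R′} → Y ≡ Y′ → X ≡ X′ → R ≡ R′ → Window Y X R → Window Y′ X′ R′
Window-cong refl refl refl w = w

Window-from-high : ∀ {Y X R} H → AgreeAbove (+ X - + R) (Γ^ Y) (u^ X ⊕ H) →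
  ValuationAtLeast (+ (X ℕ.+ R)) H → Window Y X R
Window-from-high {Y} {X} H low-agrees high-val = record
  { low = Γ^ Y ⊕ (u^ X ⊕ H)
  ; high = H
  ; split = ≋-sym reassemble
  ; low-degree = low-agrees
  ; high-valuation = high-val
  }
  where
  reassemble : u^ X ⊕ ((Γ^ Y ⊕ (u^ X ⊕ H)) ⊕ H) ≋ Γ^ Y
  reassemble = begin
    u^ X ⊕ ((Γ^ Y ⊕ (u^ X ⊕ H)) ⊕ H)  ≈⟨ ⊕-cong ≋-refl (⊕-assoc (Γ^ Y) (u^ X ⊕ H) H) ⟩
    u^ X ⊕ (Γ^ Y ⊕ ((u^ X ⊕ H) ⊕ H))  ≈⟨ ⊕-cong ≋-refl (⊕-cong ≋-refl (⊕-cancelʳ (u^ X) H)) ⟩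
    u^ X ⊕ (Γ^ Y ⊕ u^ X)              ≈⟨ ⊕-cong ≋-refl (⊕-comm (Γ^ Y) (u^ X)) ⟩
    u^ X ⊕ (u^ X ⊕ Γ^ Y)              ≈⟨ ⊕-cancelˡ (u^ X) (Γ^ Y) ⟩
    Γ^ Y                              ∎
    where open ≋-Reasoning

Window-agrees-above : ∀ {Y X R} (w : Window Y X R) → AgreeAbove (+ X - + R) (Γ^ Y) (u^ X ⊕ Window.high w)
Window-agrees-above {Y} {X} w = DegreeAtMost-resp-≋ (≋-sym low-remains) low-degree
  where
  open Window w
  low-remains : Γ^ Y ⊕ (u^ X ⊕ high) ≋ low
  low-remains = begin
    Γ^ Y ⊕ (u^ X ⊕ high)                  ≈⟨ ⊕-cong split ≋-refl ⟩
    (u^ X ⊕ (low ⊕ high)) ⊕ (u^ X ⊕ high)  ≈⟨ ⊕-cong (⊕-Properties.x∙yz≈y∙xz (u^ X) low high) ≋-refl ⟩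
    (low ⊕ (u^ X ⊕ high)) ⊕ (u^ X ⊕ high)  ≈⟨ ⊕-cancelʳ low (u^ X ⊕ high) ⟩
    low                                   ∎
    where open ≋-Reasoning

Window-shift : ∀ {Y Y′ X′ R} n {d} → d ℤ.≤ + (n ℕ.+ X′) - + R →
  AgreeAbove d (Γ^ Y) (u^ n ⊙ Γ^ Y′) → Window Y′ X′ R → Window Y (n ℕ.+ X′) R
Window-shift {Y} {Y′} {X′} {R} n d≤ Γ^Y~uⁿΓ^Y′ w = Window-from-high (u^ n ⊙ high)
  (AgreeAbove-trans (DegreeAtMost-mono d≤ Γ^Y~uⁿΓ^Y′)
    (AgreeAbove-resp-≋ ≋-refl distribute
      (subst (λ d′ → AgreeAbove d′ (u^ n ⊙ Γ^ Y′) (u^ n ⊙ (u^ X′ ⊕ high))) (shifted-bound n X′ R)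
        (AgreeAbove-⊙ˡ (DegreeAtMost-u^ n) (Window-agrees-above w)))))
  (subst (λ d′ → ValuationAtLeast (+ d′) (u^ n ⊙ high)) (sym (ℕP.+-assoc n X′ R))
    (ValuationAtLeast-⊙ (ValuationAtLeast-u^ n) high-valuation))
  where
  open Window w
  shifted-bound : ∀ n x r → + n + (+ x - + r) ≡ + (n ℕ.+ x) - + r
  shifted-bound n x r = trans (sym (ℤP.+-assoc (+ n) (+ x) (ℤ.- + r))) (cong (_- + r) (sym (ℤP.pos-+ n x)))
  distribute : u^ n ⊙ (u^ X′ ⊕ high) ≋ u^ (n ℕ.+ X′) ⊕ u^ n ⊙ high
  distribute = ≋-trans (⊙-distribˡ (u^ n) (u^ X′) high) (⊕-cong (≋-sym (u^-+ n X′)) ≋-refl)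

Window-double : ∀ {Y X R} → Window Y X R → Window (Y ℕ.+ Y) (X ℕ.+ X) (R ℕ.+ R)
Window-double {Y} {X} {R} w = record
  { low = low ⊙ low
  ; high = high ⊙ high
  ; split = split′
  ; low-degree = subst (λ d → DegreeAtMost d (low ⊙ low)) (double-low X R) (DegreeAtMost-⊙ low-degree low-degree)
  ; high-valuation = subst (λ d → ValuationAtLeast (+ d) (high ⊙ high)) (double-high X R)
      (ValuationAtLeast-⊙ high-valuation high-valuation)
  }
  where
  open Window w
  double-low : ∀ x r → (+ x - + r) + (+ x - + r) ≡ + (x ℕ.+ x) - + (r ℕ.+ r)
  double-low x r = trans (ℤ-lemma (+ x) (+ r)) (cong₂ _-_ (sym (ℤP.pos-+ x x)) (sym (ℤP.pos-+ r r)))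
    where
    ℤ-lemma : ∀ x r → (x - r) + (x - r) ≡ (x + x) - (r + r)
    ℤ-lemma = ℤ-solve-∀
  double-high : ∀ x r → (x ℕ.+ r) ℕ.+ (x ℕ.+ r) ≡ (x ℕ.+ x) ℕ.+ (r ℕ.+ r)
  double-high = ℕ-solve-∀
  split′ : Γ^ (Y ℕ.+ Y) ≋ u^ (X ℕ.+ X) ⊕ (low ⊙ low ⊕ high ⊙ high)
  split′ = begin
    Γ^ (Y ℕ.+ Y)                                     ≈⟨ Γ^-+ Y Y ⟩
    Γ^ Y ⊙ Γ^ Y                                      ≈⟨ ⊙-cong split split ⟩
    (u^ X ⊕ (low ⊕ high)) ⊙ (u^ X ⊕ (low ⊕ high))    ≈⟨ ⊕-square (u^ X) (low ⊕ high) ⟩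
    u^ X ⊙ u^ X ⊕ (low ⊕ high) ⊙ (low ⊕ high)        ≈⟨ ⊕-cong (≋-sym (u^-+ X X)) (⊕-square low high) ⟩
    u^ (X ℕ.+ X) ⊕ (low ⊙ low ⊕ high ⊙ high)         ∎
    where open ≋-Reasoning

Window-scale : ∀ m {Y X R} → Window Y X R → Window (Y ℕ.* 2 ^ m) (X ℕ.* 2 ^ m) (R ℕ.* 2 ^ m)
Window-scale zero w = Window-cong (sym (ℕP.*-identityʳ _)) (sym (ℕP.*-identityʳ _)) (sym (ℕP.*-identityʳ _)) w
Window-scale (suc m) {Y} {X} {R} w =
  Window-cong (twice Y (2 ^ m)) (twice X (2 ^ m)) (twice R (2 ^ m)) (Window-double (Window-scale m w))
  where
  twice : ∀ n p → n ℕ.* p ℕ.+ n ℕ.* p ≡ n ℕ.* (2 ℕ.* p)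
  twice = ℕ-solve-∀

Window⇒P : ∀ {Y X R} → Window Y X R → ∀ l → l ℕ.< R → P ΓCA (+ X) Y l l
Window⇒P {Y} {X} {R} w l l<R = bijective , constant
  where
  open Window w

  low-avoids-0 : ∀ {z v} → + X - + l ℤ.≤ z → z - (+ X - + R) ℤ.≤ v → ¬ v ≡ + 0
  low-avoids-0 lo le refl =
    ℕP.<⇒≱ l<R (ℤP.drop‿+≤+ (sub-cancelˡ-≤ (+ X) (ℤP.≤-trans lo (ℤP.i-j≤0⇒i≤j le))))

  high-avoids-0 : ∀ {z v} → z ℤ.≤ + X + + l → v ℤ.≤ z - + (X ℕ.+ R) → ¬ v ≡ + 0
  high-avoids-0 hi le refl =
    ℕP.<⇒≱ l<R (ℕP.+-cancelˡ-≤ X _ _ (ℤP.drop‿+≤+ (ℤP.≤-trans (ℤP.0≤i-j⇒j≤i le) hi)))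

  rest : Config 𝔽₂³ → ℤ → 𝔽₂³
  rest c z = ⟦ low ⊕ high ⟧ (φ c (vzero 3)) z

  local-split : ∀ c q z → + X - + l ℤ.≤ z → z ℤ.≤ + X + + l → local ΓCA Y z c q ≡ vadd (φ c q (z - + X)) (rest c z)
  local-split c q z lo hi = begin
    local ΓCA Y z c q                                  ≡⟨ iter-ΓCA Y (φ c q) z ⟩
    ⟦ Γ^ Y ⟧ (φ c q) z                                 ≡⟨ pointwise split (φ c q) z ⟩
    vadd (φ c q (z - + X)) (⟦ low ⊕ high ⟧ (φ c q) z)  ≡⟨ cong (vadd (φ c q (z - + X))) (cong₂ vadd low-blind high-blind) ⟩
    vadd (φ c q (z - + X)) (rest c z)                  ∎
    where
    open ≡-Reasoning
    low-blind : ⟦ low ⟧ (φ c q) z ≡ ⟦ low ⟧ (φ c (vzero 3)) z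
    low-blind = depends-above low-degree (φ c q) (φ c (vzero 3)) z λ v le →
      φ-independent-away-from-0 c q (vzero 3) v (low-avoids-0 lo le)
    high-blind : ⟦ high ⟧ (φ c q) z ≡ ⟦ high ⟧ (φ c (vzero 3)) z
    high-blind = depends-below high-valuation (φ c q) (φ c (vzero 3)) z λ v le →
      φ-independent-away-from-0 c q (vzero 3) v (high-avoids-0 hi le)

  bijective : ∀ c → Bijective _≡_ _≡_ (local ΓCA Y (+ X) c)
  bijective c = translation-bijective _ λ q →
    trans (local-split c q (+ X) (ℤP.i-j≤i (+ X) (+ l)) (ℤP.i≤i+j (+ X) (+ l)))
          (cong (λ v → vadd v (rest c (+ X))) (trans (cong (φ c q) (ℤP.+-inverseʳ (+ X))) (φ-at-0 c q)))

  constant : ∀ c z → + X - + l ℤ.≤ z → z ℤ.≤ + X + + l → ¬ z ≡ + X → Constant (local ΓCA Y z c)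
  constant c z lo hi z≢X q q′ = begin
    local ΓCA Y z c q                   ≡⟨ local-split c q z lo hi ⟩
    vadd (φ c q (z - + X)) (rest c z)   ≡⟨ cong (λ v → vadd v (rest c z)) (φ-independent-away-from-0 c q q′ _ z-X≢0) ⟩
    vadd (φ c q′ (z - + X)) (rest c z)  ≡⟨ local-split c q′ z lo hi ⟨
    local ΓCA Y z c q′                  ∎
    where
    open ≡-Reasoning
    z-X≢0 : ¬ z - + X ≡ + 0
    z-X≢0 z-X≡0 = z≢X (ℤP.i-j≡0⇒i≡j z (+ X) z-X≡0)

Γ^-u^-commute : ∀ a n b → Γ^ a ⊙ (u^ n ⊙ Γ^ b) ≋ u^ n ⊙ Γ^ (a ℕ.+ b)
Γ^-u^-commute a n b = begin
  Γ^ a ⊙ (u^ n ⊙ Γ^ b)  ≈⟨ ⊙-assoc (Γ^ a) (u^ n) (Γ^ b) ⟨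
  (Γ^ a ⊙ u^ n) ⊙ Γ^ b  ≈⟨ ⊙-cong (⊙-comm (Γ^ a) (u^ n)) ≋-refl ⟩
  (u^ n ⊙ Γ^ a) ⊙ Γ^ b  ≈⟨ ⊙-assoc (u^ n) (Γ^ a) (Γ^ b) ⟩
  u^ n ⊙ (Γ^ a ⊙ Γ^ b)  ≈⟨ ⊙-cong ≋-refl (Γ^-+ a b) ⟨
  u^ n ⊙ Γ^ (a ℕ.+ b)   ∎
  where open ≋-Reasoning

Γ^8-agrees-below : AgreeBelow (+ 5) (Γ^ 8) 𝟏
Γ^8-agrees-below = ValuationAtLeast-by-nf 5 (Γ^ 8 ⊕ 𝟏) _

Γ^8q-agrees-below : ∀ q → AgreeBelow (+ 5) (Γ^ (q ℕ.* 8)) 𝟏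
Γ^8q-agrees-below zero = ValuationAtLeast-resp-≋ (≋-sym (⊕-self 𝟏)) ValuationAtLeast-𝟎
Γ^8q-agrees-below (suc q) = AgreeBelow-resp-≋ (≋-sym (Γ^-+ 8 (q ℕ.* 8))) (⊙-identityˡ 𝟏)
  (AgreeBelow-⊙ Γ^8-agrees-below (Γ^8q-agrees-below q))

Window-Γ^8q : ∀ q → Window (q ℕ.* 8) 0 5
Window-Γ^8q q = Window-from-high (Γ^ (q ℕ.* 8) ⊕ u^ 0)
  (≋⇒AgreeAbove (≋-sym (≋-trans (⊕-cong ≋-refl (⊕-comm (Γ^ (q ℕ.* 8)) (u^ 0))) (⊕-cancelˡ (u^ 0) (Γ^ (q ℕ.* 8))))))
  (AgreeBelow-resp-≋ ≋-refl (≋-sym u^0≋𝟏) (Γ^8q-agrees-below q))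

-- The terms of Γ^40 of degree at least 37.
Γ^40-high : Expr
Γ^40-high = u^ 36 ⊙ (Γ^ 2 ⊕ 𝟏) ⊕ u^ 38 ⊙ (Γ^ 2 ⊕ 𝟏) ⊕ u^ 38 ⊙ Γ ⊕ u^ 38

Window-Γ^40 : Window 40 32 5
Window-Γ^40 = Window-from-high Γ^40-high (DegreeAtMost-by-nf 27 _ _) (ValuationAtLeast-by-nf 37 Γ^40-high _)

Γ^64-agrees-above : AgreeAbove (+ 48) (Γ^ 64) (u^ 32 ⊙ Γ^ 32)
Γ^64-agrees-above = DegreeAtMost-by-nf 48 _ _

Γ^32q+32-agrees-above : ∀ q → AgreeAbove (+ (q ℕ.* 32 ℕ.+ 16)) (Γ^ (q ℕ.* 32 ℕ.+ 32)) (u^ (q ℕ.* 32) ⊙ Γ^ 32)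
Γ^32q+32-agrees-above zero = ≋⇒AgreeAbove (≋-sym (≋-trans (⊙-cong u^0≋𝟏 ≋-refl) (⊙-identityˡ (Γ^ 32))))
Γ^32q+32-agrees-above (suc q) = AgreeAbove-trans
  (AgreeAbove-resp-≋ (≋-sym (Γ^-+ 32 (q ℕ.* 32 ℕ.+ 32))) (Γ^-u^-commute 32 (q ℕ.* 32) 32)
    (AgreeAbove-⊙ˡ (DegreeAtMost-Γ^ 32) (Γ^32q+32-agrees-above q)))
  (subst (λ d → AgreeAbove (+ d) (u^ (q ℕ.* 32) ⊙ Γ^ 64) (u^ (suc q ℕ.* 32) ⊙ Γ^ 32)) (bound (q ℕ.* 32))
    (AgreeAbove-resp-≋ ≋-refl merge (AgreeAbove-⊙ˡ (DegreeAtMost-u^ (q ℕ.* 32)) Γ^64-agrees-above)))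
  where
  bound : ∀ n → n ℕ.+ 48 ≡ 32 ℕ.+ n ℕ.+ 16
  bound = ℕ-solve-∀
  merge : u^ (q ℕ.* 32) ⊙ (u^ 32 ⊙ Γ^ 32) ≋ u^ (suc q ℕ.* 32) ⊙ Γ^ 32
  merge = ≋-trans (≋-sym (⊙-assoc (u^ (q ℕ.* 32)) (u^ 32) (Γ^ 32)))
    (⊙-cong (≋-trans (≋-sym (u^-+ (q ℕ.* 32) 32)) (≋-reflexive (cong u^_ (ℕP.+-comm (q ℕ.* 32) 32)))) ≋-refl)

Γ^32q+40-agrees-above : ∀ q → AgreeAbove (+ (q ℕ.* 32 ℕ.+ 24)) (Γ^ (q ℕ.* 32 ℕ.+ 40)) (u^ (q ℕ.* 32) ⊙ Γ^ 40)
Γ^32q+40-agrees-above q =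
  subst (λ d → AgreeAbove (+ d) (Γ^ (q ℕ.* 32 ℕ.+ 40)) (u^ (q ℕ.* 32) ⊙ Γ^ 40)) (bound (q ℕ.* 32))
    (AgreeAbove-resp-≋ (≋-trans (≋-sym (Γ^-+ 8 (q ℕ.* 32 ℕ.+ 32))) (≋-reflexive (cong Γ^_ (exponent (q ℕ.* 32)))))
      (Γ^-u^-commute 8 (q ℕ.* 32) 32)
      (AgreeAbove-⊙ˡ (DegreeAtMost-Γ^ 8) (Γ^32q+32-agrees-above q)))
  where
  bound : ∀ n → 8 ℕ.+ (n ℕ.+ 16) ≡ n ℕ.+ 24
  bound = ℕ-solve-∀
  exponent : ∀ n → 8 ℕ.+ (n ℕ.+ 32) ≡ n ℕ.+ 40
  exponent = ℕ-solve-∀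

Window-Γ^32q+40 : ∀ q → Window (q ℕ.* 32 ℕ.+ 40) (q ℕ.* 32 ℕ.+ 32) 5
Window-Γ^32q+40 q = Window-shift (q ℕ.* 32) (bound (q ℕ.* 32)) (Γ^32q+40-agrees-above q) Window-Γ^40
  where
  bound : ∀ n → + (n ℕ.+ 24) ℤ.≤ + (n ℕ.+ 32) - + 5
  bound n = ℤP.≤-trans (ℤ.+≤+ (ℕP.+-monoʳ-≤ n (ℕP.m≤m+n 24 3)))
    (ℤP.≤-reflexive (trans (ℤP.pos-+ n 27) (trans (shift (+ n)) (cong (_- + 5) (sym (ℤP.pos-+ n 32))))))
    where
    shift : ∀ x → x + + 27 ≡ x + + 32 - + 5
    shift = ℤ-solve-∀

2^m<5*2^m : ∀ m → 2 ^ m ℕ.< 5 ℕ.* 2 ^ m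
2^m<5*2^m m = ℕP.m<m+n (2 ^ m) (ℕP.<-≤-trans (ℕP.m^n>0 2 m) (ℕP.m≤m+n (2 ^ m) _))

Window⇒InX2 : ∀ {Y X} → Window Y X 5 → ∀ j → InX2 ΓCA (+ X) Y j
Window⇒InX2 {Y} {X} w j = j , j , ℕP.≤-refl , ℕP.≤-refl , λ n _ →
  subst (λ x → P ΓCA x (Y ℕ.* 2 ^ (n ℕ.∸ j)) (2 ^ (n ℕ.∸ j)) (2 ^ (n ℕ.∸ j))) (ℤP.pos-* X (2 ^ (n ℕ.∸ j)))
    (Window⇒P (Window-scale (n ℕ.∸ j) w) (2 ^ (n ℕ.∸ j)) (2^m<5*2^m (n ℕ.∸ j)))

-- 2 ^ j − 1, in the shape in which multiplying unnormalised denominators produces it.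
pred2^ : ℕ → ℕ
pred2^ zero = 0
pred2^ (suc j) = pred2^ j ℕ.+ suc (pred2^ j ℕ.+ 0)

suc-pred2^ : ∀ j → suc (pred2^ j) ≡ 2 ^ j
suc-pred2^ zero = refl
suc-pred2^ (suc j) rewrite sym (suc-pred2^ j) = refl

toℚᵘ-half^ : ∀ j → ℚ.toℚᵘ (half^ j) ℚᵘ.≃ mkℚᵘ (+ 1) (pred2^ j)
toℚᵘ-half^ zero = ℚᵘP.≃-refl
toℚᵘ-half^ (suc j) = ℚᵘP.≃-trans (ℚP.toℚᵘ-homo-* ½ (half^ j)) (ℚᵘP.*-congˡ {ℚ.toℚᵘ ½} (toℚᵘ-half^ j))

toℚᵘ-dyadic : ∀ a j → ℚ.toℚᵘ (dyadic a j) ℚᵘ.≃ mkℚᵘ a (pred2^ j)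
toℚᵘ-dyadic a j = ℚᵘP.≃-trans (ℚP.toℚᵘ-homo-* (a ℚ./ 1) (half^ j))
  (ℚᵘP.≃-trans (ℚᵘP.*-cong (ℚP.toℚᵘ-fromℚᵘ (mkℚᵘ a 0)) (toℚᵘ-half^ j)) (*≡* (cross a (pred2^ j))))
  where
  cross : ∀ a m → (a ℤ.* + 1) ℤ.* + suc m ≡ a ℤ.* + (suc m ℕ.+ 0)
  cross a m rewrite ℕP.+-identityʳ (suc m) | ℤP.*-identityʳ a = refl

∣⊖∣≤ : ∀ m n b → m ℕ.≤ n ℕ.+ b → n ℕ.≤ m ℕ.+ b → ℤ.∣ m ⊖ n ∣ ℕ.≤ b
∣⊖∣≤ m n b m≤n+b n≤m+b with ℕP.≤-total m n
... | inj₁ m≤n = subst (ℕ._≤ b) (sym (ℤP.∣⊖∣-≤ m≤n)) (ℕP.m≤n+o⇒m∸n≤o n m n≤m+b)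
... | inj₂ n≤m =
  subst (ℕ._≤ b) (sym (trans (ℤP.∣m⊖n∣≡∣n⊖m∣ m n) (ℤP.∣⊖∣-≤ n≤m))) (ℕP.m≤n+o⇒m∸n≤o m n m≤n+b)

scaled-bound : ∀ n d F S e → n ℕ.≤ 40 ℕ.* suc d → 40 ℕ.* F ℕ.< S → n ℕ.* F ℕ.< suc e ℕ.* (S ℕ.* suc d)
scaled-bound n d F S e n≤ 40F<S = begin-strict
  n ℕ.* F                ≤⟨ ℕP.*-monoˡ-≤ F n≤ ⟩
  40 ℕ.* suc d ℕ.* F     ≡⟨ regroup (suc d) F ⟩
  suc d ℕ.* (40 ℕ.* F)   <⟨ ℕP.*-monoʳ-< (suc d) 40F<S ⟩
  suc d ℕ.* S            ≡⟨ ℕP.*-comm (suc d) S ⟩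
  S ℕ.* suc d            ≤⟨ ℕP.m≤m+n (S ℕ.* suc d) _ ⟩
  suc e ℕ.* (S ℕ.* suc d) ∎
  where
  open ℕP.≤-Reasoning
  regroup : ∀ D F → 40 ℕ.* D ℕ.* F ≡ D ℕ.* (40 ℕ.* F)
  regroup = ℕ-solve-∀

∣dyadic-−-ratio∣< : ∀ a j P dm .(cop : Coprime P (suc dm)) e fm .(cop′ : Coprime (suc e) (suc fm)) →
  a ℕ.* suc dm ℕ.≤ P ℕ.* 2 ^ j ℕ.+ 40 ℕ.* suc dm → P ℕ.* 2 ^ j ℕ.≤ a ℕ.* suc dm ℕ.+ 40 ℕ.* suc dm →
  40 ℕ.* suc fm ℕ.< 2 ^ j →
  ℚ.∣ dyadic (+ a) j ℚ.- mkℚ (+ P) dm cop ∣ ℚ.< mkℚ +[1+ e ] fm cop′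
∣dyadic-−-ratio∣< a j P dm cop e fm cop′ below above 40F<S =
  ℚP.toℚᵘ-cancel-< (ℚᵘP.<-respˡ-≃ (ℚᵘP.≃-sym unnormalise) (*<* cross-multiplied))
  where
  x = dyadic (+ a) j
  t = mkℚ (+ P) dm cop
  D = suc dm
  S = 2 ^ j
  unnormalise : ℚ.toℚᵘ ℚ.∣ x ℚ.- t ∣ ℚᵘ.≃ ℚᵘ.∣ mkℚᵘ (+ a) (pred2^ j) ℚᵘ.+ (ℚᵘ.- mkℚᵘ (+ P) dm) ∣
  unnormalise = ℚᵘP.≃-trans (ℚP.toℚᵘ-homo-∣-∣ (x ℚ.- t)) (ℚᵘP.∣-∣-cong
    (ℚᵘP.≃-trans (ℚP.toℚᵘ-homo-+ x (ℚ.- t)) (ℚᵘP.+-cong (toℚᵘ-dyadic (+ a) j) (ℚP.toℚᵘ-homo‿- t))))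
  numerator : + a ℤ.* + D ℤ.+ (ℤ.- + P) ℤ.* + S ≡ (a ℕ.* D) ⊖ (P ℕ.* S)
  numerator = trans (rearrange (+ a) (+ D) (+ P) (+ S))
    (trans (cong₂ _-_ (sym (ℤP.pos-* a D)) (sym (ℤP.pos-* P S))) (ℤP.m-n≡m⊖n (a ℕ.* D) (P ℕ.* S)))
    where
    rearrange : ∀ a d p s → a ℤ.* d ℤ.+ (ℤ.- p) ℤ.* s ≡ a ℤ.* d - p ℤ.* s
    rearrange = ℤ-solve-∀
  cross-multiplied : + ℤ.∣ + a ℤ.* + D ℤ.+ (ℤ.- + P) ℤ.* + suc (pred2^ j) ∣ ℤ.* + suc fm ℤ.<
                     +[1+ e ] ℤ.* + (suc (pred2^ j) ℕ.* D)
  cross-multiplied =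
    subst (λ s → + ℤ.∣ + a ℤ.* + D ℤ.+ (ℤ.- + P) ℤ.* + s ∣ ℤ.* + suc fm ℤ.< +[1+ e ] ℤ.* + (s ℕ.* D))
      (sym (suc-pred2^ j))
      (subst (λ n → + ℤ.∣ n ∣ ℤ.* + suc fm ℤ.< +[1+ e ] ℤ.* + (S ℕ.* D)) (sym numerator)
        (subst₂ ℤ._<_ (ℤP.pos-* ℤ.∣ (a ℕ.* D) ⊖ (P ℕ.* S) ∣ (suc fm)) (ℤP.pos-* (suc e) (S ℕ.* D))
          (ℤ.+<+ (scaled-bound _ dm (suc fm) S e (∣⊖∣≤ (a ℕ.* D) (P ℕ.* S) (40 ℕ.* D) below above) 40F<S))))

n<2^n : ∀ n → n ℕ.< 2 ^ n
n<2^n zero = ℕP.≤-refl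
n<2^n (suc n) = ℕP.+-mono-≤-< (ℕP.m^n>0 2 n) (ℕP.<-≤-trans (n<2^n n) (ℕP.m≤m+n (2 ^ n) 0))

near-multiple-of-32 : ∀ N dm r → r ℕ.≤ 40 → let K = N / (32 ℕ.* suc dm) in
  (K ℕ.* 32 ℕ.+ r) ℕ.* suc dm ℕ.≤ N ℕ.+ 40 ℕ.* suc dm × N ℕ.≤ (K ℕ.* 32 ℕ.+ r) ℕ.* suc dm ℕ.+ 40 ℕ.* suc dm
near-multiple-of-32 N dm r r≤40 = below , above
  where
  open ℕP.≤-Reasoning
  D = suc dm
  K = N / (32 ℕ.* D)
  expand : ∀ K r D → (K ℕ.* 32 ℕ.+ r) ℕ.* D ≡ K ℕ.* (32 ℕ.* D) ℕ.+ r ℕ.* D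
  expand = ℕ-solve-∀
  below : (K ℕ.* 32 ℕ.+ r) ℕ.* D ℕ.≤ N ℕ.+ 40 ℕ.* D
  below = begin
    (K ℕ.* 32 ℕ.+ r) ℕ.* D        ≡⟨ expand K r D ⟩
    K ℕ.* (32 ℕ.* D) ℕ.+ r ℕ.* D  ≤⟨ ℕP.+-mono-≤ (m/n*n≤m N (32 ℕ.* D)) (ℕP.*-monoˡ-≤ D r≤40) ⟩
    N ℕ.+ 40 ℕ.* D                ∎
  above : N ℕ.≤ (K ℕ.* 32 ℕ.+ r) ℕ.* D ℕ.+ 40 ℕ.* D
  above = begin
    N                                       ≡⟨ m≡m%n+[m/n]*n N (32 ℕ.* D) ⟩
    N % (32 ℕ.* D) ℕ.+ K ℕ.* (32 ℕ.* D)     ≤⟨ ℕP.+-monoˡ-≤ _ (ℕP.<⇒≤ (m%n<n N (32 ℕ.* D))) ⟩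
    32 ℕ.* D ℕ.+ K ℕ.* (32 ℕ.* D)           ≤⟨ ℕP.+-monoˡ-≤ _ 32D≤rD+40D ⟩
    r ℕ.* D ℕ.+ 40 ℕ.* D ℕ.+ K ℕ.* (32 ℕ.* D) ≡⟨ regroup K r D ⟩
    (K ℕ.* 32 ℕ.+ r) ℕ.* D ℕ.+ 40 ℕ.* D     ∎
    where
    32D≤rD+40D : 32 ℕ.* D ℕ.≤ r ℕ.* D ℕ.+ 40 ℕ.* D
    32D≤rD+40D = ℕP.≤-trans (ℕP.*-monoˡ-≤ D (ℕP.m≤m+n 32 8)) (ℕP.m≤n+m _ (r ℕ.* D))
    regroup : ∀ K r D → r ℕ.* D ℕ.+ 40 ℕ.* D ℕ.+ K ℕ.* (32 ℕ.* D) ≡ (K ℕ.* 32 ℕ.+ r) ℕ.* D ℕ.+ 40 ℕ.* D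
    regroup = ℕ-solve-∀

dyadic-approximation : ∀ t → 0ℚ ≤ t → ∀ ε → 0ℚ ℚ.< ε →
  Σ ℕ λ j → Σ ℕ λ K → ∀ r → r ℕ.≤ 40 → ℚ.∣ dyadic (+ (K ℕ.* 32 ℕ.+ r)) j ℚ.- t ∣ ℚ.< ε
dyadic-approximation (mkℚ -[1+ _ ] _ _) 0≤t = ⊥-elim (ℤ.NonNegative.nonNeg (ℚ.nonNegative 0≤t))
dyadic-approximation (mkℚ (+ _) _ _) _ (mkℚ (+ 0) _ _) 0<ε = ⊥-elim (ℤ.Positive.pos (ℚ.positive 0<ε))
dyadic-approximation (mkℚ (+ _) _ _) _ (mkℚ -[1+ _ ] _ _) 0<ε = ⊥-elim (ℤ.Positive.pos (ℚ.positive 0<ε))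
dyadic-approximation (mkℚ (+ P) dm cop) _ (mkℚ +[1+ e ] fm cop′) _ = j , K , close
  where
  j = 40 ℕ.* suc fm
  K = P ℕ.* 2 ^ j / (32 ℕ.* suc dm)
  close : ∀ r → r ℕ.≤ 40 → ℚ.∣ dyadic (+ (K ℕ.* 32 ℕ.+ r)) j ℚ.- mkℚ (+ P) dm cop ∣ ℚ.< mkℚ +[1+ e ] fm cop′
  close r r≤40 = let below , above = near-multiple-of-32 (P ℕ.* 2 ^ j) dm r r≤40 in
    ∣dyadic-−-ratio∣< (K ℕ.* 32 ℕ.+ r) j P dm cop e fm cop′ below above (n<2^n j)

dyadic-0-close : ∀ j ε → 0ℚ ℚ.< ε → ℚ.∣ dyadic (+ 0) j ℚ.- 0ℚ ∣ ℚ.< ε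
dyadic-0-close j ε 0<ε = subst (ℚ._< ε) (cong (λ x → ℚ.∣ x ℚ.- 0ℚ ∣) (sym (ℚP.*-zeroˡ (half^ j)))) 0<ε

mainTheorem11 : (t : ℚ) → 0ℚ ≤ t →
    InClosureX2 ΓCA 0ℚ t × InClosureX2 ΓCA t t
mainTheorem11 t 0≤t = vertical , diagonal
  where
  vertical : InClosureX2 ΓCA 0ℚ t
  vertical ε 0<ε = let j , K , close = dyadic-approximation t 0≤t ε 0<ε in
    + 0 , K ℕ.* 32 ℕ.+ 0 , j ,
    Window⇒InX2 (Window-cong (exponent K) refl refl (Window-Γ^8q (K ℕ.* 4))) j ,
    dyadic-0-close j ε 0<ε , close 0 ℕ.z≤n
    where
    exponent : ∀ K → K ℕ.* 4 ℕ.* 8 ≡ K ℕ.* 32 ℕ.+ 0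
    exponent = ℕ-solve-∀
  diagonal : InClosureX2 ΓCA t t
  diagonal ε 0<ε = let j , K , close = dyadic-approximation t 0≤t ε 0<ε in
    + (K ℕ.* 32 ℕ.+ 32) , K ℕ.* 32 ℕ.+ 40 , j , Window⇒InX2 (Window-Γ^32q+40 K) j ,
    close 32 (ℕP.m≤m+n 32 8) , close 40 ℕP.≤-refl
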